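{- Let $p\colon(Y,y_0)\to(X,x_0)$ be a pointed covering. If $Y$ is simply connected, then $p$ is a universal cover.
   Context: Graphs are simple undirected loopless graphs; graph maps send adjacent vertices to equal or adjacent vertices. $I_n$ has vertices $0,\dots,n$, edges $i\sim i+1$; paths are graph maps $I_n\to X$. A graph is simply connected if it is path-connected and its fundamental group $A_1(Y,y)$ (path-homotopy classes of finite loops at $y$: path-components of the quotient of $\coprod_nP_nY(y,y)$ by reparametrization along surjective order-preserving maps $I_m\to I_n$, where $P_nY(y,y)$ has loops of length $n$ as vertices, adjacent iff distinct and pointwise equal-or-adjacent; product by concatenation) is trivial for every vertex $y$. A graph map $p\colon Y\to X$ is a covering map if (i) for every vertex $y$, $p$ restricts to a bijection from $y$ together with its neighbours onto $p(y)$ together with its neighbours, and (ii) for all graph maps $u\colon I_3\to Y$, $v\colon I_1\square I_1\to X$ ($I_1\square I_1$ the $4$-cycle on $\{0,1\}^2$) with $p(u(0))=v(1,0)$, $p(u(1))=v(0,0)$, $p(u(2))=v(0,1)$, $p(u(3))=v(1,1)$, one has $u(0)=u(3)$ or $u(0)\sim u(3)$. A pointed covering is a base-point preserving covering map; the category $\mathsf{Cov}(X,x_0)$ has pointed coverings of $(X,x_0)$ as objects and base-point preserving graph maps $f$ with $p'\circ f=p$ as morphisms. A universal cover is an initial object of $\mathsf{Cov}(X,x_0)$. -}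

module Defs where

open import Data.Nat using (ℕ; zero; suc; _≤_)
open import Data.Fin using (Fin; toℕ; fromℕ) renaming (zero to fzero)
import Data.Fin as Fin
open import Data.Bool using (Bool)
open import Data.Product using (Σ; _×_; _,_; ∃; proj₁; proj₂)
open import Data.Sum using (_⊎_)
open import Relation.Nullary using (¬_)
open import Relation.Binary.PropositionalEquality using (_≡_) renaming (sym to ≡-sym)
open import Relation.Binary.Construct.Closure.Equivalence using (EqClosure)

record Graph : Set₁ where
  field
    V     : Set
    E     : V → V → Set
    E-sym : ∀ {x y} → E x y → E y x
    E-irrefl : ∀ {x} → ¬ E x x
open Graph public

_⊢_≃_ : (G : Graph) → V G → V G → Set
G ⊢ x ≃ y = x ≡ y ⊎ E G x y

record GraphMap (G H : Graph) : Set where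
  field
    fun  : V G → V H
    pres : ∀ {x y} → E G x y → H ⊢ fun x ≃ fun y
open GraphMap public

I : ℕ → Graph
I n = record
  { V = Fin (suc n)
  ; E = λ i j → (toℕ j ≡ suc (toℕ i)) ⊎ (toℕ i ≡ suc (toℕ j))
  ; E-sym = λ { (_⊎_.inj₁ e) → _⊎_.inj₂ e ; (_⊎_.inj₂ e) → _⊎_.inj₁ e }
  ; E-irrefl = irr
  }
  where
  open import Data.Nat.Properties using (1+n≢n)
  import Relation.Binary.PropositionalEquality
  irr : ∀ {i} → ¬ ((toℕ i ≡ suc (toℕ i)) ⊎ (toℕ i ≡ suc (toℕ i)))
  irr {i} (_⊎_.inj₁ e) = 1+n≢n (Relation.Binary.PropositionalEquality.sym e)
  irr {i} (_⊎_.inj₂ e) = 1+n≢n (Relation.Binary.PropositionalEquality.sym e)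

□E : (G H : Graph) → V G × V H → V G × V H → Set
□E G H (x , y) (x' , y') = (x ≡ x' × E H y y') ⊎ (E G x x' × y ≡ y')

□E-sym : (G H : Graph) → ∀ {a b} → □E G H a b → □E G H b a
□E-sym G H (_⊎_.inj₁ (e , h)) = _⊎_.inj₁ (≡-sym e , Graph.E-sym H h)
□E-sym G H (_⊎_.inj₂ (g , e)) = _⊎_.inj₂ (Graph.E-sym G g , ≡-sym e)

□E-irrefl : (G H : Graph) → ∀ {a} → ¬ □E G H a a
□E-irrefl G H (_⊎_.inj₁ (_ , h)) = Graph.E-irrefl H h
□E-irrefl G H (_⊎_.inj₂ (g , _)) = Graph.E-irrefl G g

_□_ : Graph → Graph → Graph
G □ H = record
  { V = V G × V H
  ; E = □E G H
  ; E-sym = □E-sym G H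
  ; E-irrefl = □E-irrefl G H
  }

Path : Graph → ℕ → Set
Path X n = GraphMap (I n) X

record Loop (X : Graph) (y : V X) (n : ℕ) : Set where
  field
    path  : Path X n
    start : fun path fzero ≡ y
    end   : fun path (fromℕ n) ≡ y
open Loop public

AnyLoop : (X : Graph) → V X → Set
AnyLoop X y = Σ ℕ (Loop X y)

record Reparam (m n : ℕ) : Set where
  field
    r    : Fin (suc m) → Fin (suc n)
    mono : ∀ i j → toℕ i ≤ toℕ j → toℕ (r i) ≤ toℕ (r j)
    surj : ∀ j → ∃ λ i → r i ≡ j

-- generating relation for path-homotopy of loops:
-- adjacency in P_n X(y,y) (pointwise equal-or-adjacent), and reparametrization
data HStep (X : Graph) (y : V X) : AnyLoop X y → AnyLoop X y → Set where
  adj : ∀ {n} (α β : Loop X y n) →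
        (∀ i → X ⊢ fun (path α) i ≃ fun (path β) i) →
        HStep X y (n , α) (n , β)
  rep : ∀ {m n} (α : Loop X y m) (β : Loop X y n) (ρ : Reparam m n) →
        (∀ i → fun (path α) i ≡ fun (path β) (Reparam.r ρ i)) →
        HStep X y (m , α) (n , β)

-- same class in A_1(X,y): same path-component of the quotient
PathHomotopic : (X : Graph) (y : V X) → AnyLoop X y → AnyLoop X y → Set
PathHomotopic X y = EqClosure (HStep X y)

constLoop : (X : Graph) (y : V X) → AnyLoop X y
constLoop X y = 0 , record
  { path = record { fun = λ _ → y ; pres = λ _ → _⊎_.inj₁ _≡_.refl }
  ; start = _≡_.refl ; end = _≡_.refl }

PathConnected : Graph → Set
PathConnected X = ∀ x x' → Σ ℕ λ n → Σ (Path X n) λ γ →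
  (fun γ fzero ≡ x) × (fun γ (fromℕ n) ≡ x')

SimplyConnected : Graph → Set
SimplyConnected Y = PathConnected Y ×
  (∀ y (ℓ : AnyLoop Y y) → PathHomotopic Y y ℓ (constLoop Y y))

N[_]_∋_ : (G : Graph) → V G → V G → Set
N[ G ] y ∋ z = G ⊢ y ≃ z

record IsCovering {Y X : Graph} (p : GraphMap Y X) : Set where
  field
    -- (i) bijection N[y] → N[p y]
    locInj  : ∀ y z z' → N[ Y ] y ∋ z → N[ Y ] y ∋ z' →
              fun p z ≡ fun p z' → z ≡ z'
    locSurj : ∀ y w → N[ X ] (fun p y) ∋ w →
              Σ (V Y) λ z → N[ Y ] y ∋ z × fun p z ≡ w
    square  : (u : GraphMap (I 3) Y) (v : GraphMap (I 1 □ I 1) X) →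
              fun p (fun u (Fin.zero)) ≡ fun v (Fin.suc Fin.zero , Fin.zero) →
              fun p (fun u (Fin.suc Fin.zero)) ≡ fun v (Fin.zero , Fin.zero) →
              fun p (fun u (Fin.suc (Fin.suc Fin.zero))) ≡ fun v (Fin.zero , Fin.suc Fin.zero) →
              fun p (fun u (Fin.suc (Fin.suc (Fin.suc Fin.zero)))) ≡ fun v (Fin.suc Fin.zero , Fin.suc Fin.zero) →
              Y ⊢ fun u Fin.zero ≃ fun u (Fin.suc (Fin.suc (Fin.suc Fin.zero)))

record PointedCovering (X : Graph) (x₀ : V X) : Set₁ where
  field
    Tot   : Graph
    base  : V Tot
    proj  : GraphMap Tot X
    cov   : IsCovering proj
    pt    : fun proj base ≡ x₀
open PointedCovering public

record CovMor {X : Graph} {x₀ : V X} (P Q : PointedCovering X x₀) : Set where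
  field
    map  : GraphMap (Tot P) (Tot Q)
    pt   : fun map (base P) ≡ base Q
    comm : ∀ y → fun (proj Q) (fun map y) ≡ fun (proj P) y
open CovMor public

-- initial object (morphisms compared by their underlying vertex functions)
IsUniversalCover : {X : Graph} {x₀ : V X} → PointedCovering X x₀ → Set₁
IsUniversalCover {X} {x₀} P = (Q : PointedCovering X x₀) →
  Σ (CovMor P Q) λ f → ∀ (g : CovMor P Q) → ∀ y → fun (map g) y ≡ fun (map f) y

-- Given a pointed covering Q, send y ∈ Y to the endpoint of the lift to Q, from the base point, of
-- the image in X of a path from y₀ to y. Two paths from y₀ to y combine into a loop at y₀ which is
-- null-homotopic because Y is simply connected; the endpoint of a lifted loop is a homotopy
-- invariant (adjacent loops lift to adjacent loops by the square condition, reparametrised loops to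
-- reparametrised lifts by uniqueness of lifts), so the lifted loop is closed and the map is well
-- defined. Extending a path by one edge then shows it is a graph map, and uniqueness of lifts makes
-- it the only morphism of coverings.
module Submission where

open import Defs
open import Function using (_∘_)
open import Data.Nat using (ℕ; zero; suc; _+_; _∸_; _≤_; _<_; z≤n; s≤s)
open import Data.Nat.Properties
  using (≤-refl; ≤-trans; ≤-antisym; ≤-pred; n≤1+n; ≮⇒≥; 1+n≰n; m≤n⇒m<n∨m≡n; _≤?_; ≰⇒>;
         +-comm; +-∸-assoc; m+n∸n≡m; m∸[m∸n]≡n)
open import Data.Fin using (Fin; toℕ; fromℕ; fromℕ<) renaming (zero to fzero; suc to fsuc)
open import Data.Fin.Properties using (toℕ-fromℕ; toℕ-fromℕ<; toℕ≤pred[n])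
open import Data.Product using (Σ; _×_; _,_; proj₁; proj₂)
open import Data.Sum using (_⊎_; inj₁; inj₂)
open import Data.Empty using (⊥; ⊥-elim)
open import Relation.Nullary using (yes; no)
open import Relation.Binary.PropositionalEquality
  using (_≡_; refl; sym; trans; cong; subst; subst₂; isEquivalence; module ≡-Reasoning)
open import Relation.Binary.Construct.Closure.Equivalence using (gmap; gfold)

≃-refl : (G : Graph) → ∀ {x} → G ⊢ x ≃ x
≃-refl G = inj₁ refl

≃-sym : (G : Graph) → ∀ {x y} → G ⊢ x ≃ y → G ⊢ y ≃ x
≃-sym G (inj₁ refl) = inj₁ refl
≃-sym G (inj₂ e)    = inj₂ (E-sym G e)

≃-map : ∀ {G H} (f : GraphMap G H) {x y} → G ⊢ x ≃ y → H ⊢ fun f x ≃ fun f y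
≃-map f (inj₁ refl) = inj₁ refl
≃-map f (inj₂ e)    = pres f e

_∘ᴳ_ : ∀ {G H K} → GraphMap H K → GraphMap G H → GraphMap G K
g ∘ᴳ f = record { fun = fun g ∘ fun f ; pres = ≃-map g ∘ pres f }

square-map : (G : Graph) (c : Fin 2 → Fin 2 → V G) →
             (∀ i → G ⊢ c i fzero ≃ c i (fsuc fzero)) →
             (∀ j → G ⊢ c fzero j ≃ c (fsuc fzero) j) →
             GraphMap (I 1 □ I 1) G
square-map G c side rung = record { fun = λ (i , j) → c i j ; pres = pres′ }
  where
  along : (h : Fin 2 → V G) → G ⊢ h fzero ≃ h (fsuc fzero) →
          ∀ {j j'} → E (I 1) j j' → G ⊢ h j ≃ h j'
  along h s {fzero}      {fzero}      e = ⊥-elim (E-irrefl (I 1) e)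
  along h s {fzero}      {fsuc fzero} _ = s
  along h s {fsuc fzero} {fzero}      _ = ≃-sym G s
  along h s {fsuc fzero} {fsuc fzero} e = ⊥-elim (E-irrefl (I 1) e)

  pres′ : ∀ {s t} → E (I 1 □ I 1) s t → G ⊢ c (proj₁ s) (proj₂ s) ≃ c (proj₁ t) (proj₂ t)
  pres′ {i , _} (inj₁ (refl , h)) = along (c i) (side i) h
  pres′ {_ , j} (inj₂ (g , refl)) = along (λ i → c i j) (rung j) g

-- Walks are ℕ-indexed so that they can be concatenated, reversed and lifted without index
-- arithmetic in Fin; a path of length n becomes the walk that stays at its endpoint after time n.
record Walk (G : Graph) : Set where
  constructor walk
  field
    at   : ℕ → V G
    step : ∀ k → G ⊢ at k ≃ at (suc k)
open Walk public

module _ {G : Graph} where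

  constWalk : V G → Walk G
  constWalk x = walk (λ _ → x) (λ _ → ≃-refl G)

  edgeWalk : ∀ {x y} → E G x y → Walk G
  edgeWalk {x} {y} e = walk endpoints steps
    where
    endpoints : ℕ → V G
    endpoints zero    = x
    endpoints (suc _) = y
    steps : ∀ k → G ⊢ endpoints k ≃ endpoints (suc k)
    steps zero    = inj₂ e
    steps (suc _) = ≃-refl G

  tail : Walk G → Walk G
  tail w = walk (at w ∘ suc) (step w ∘ suc)

  reindex : (w : Walk G) (s : ℕ → ℕ) → (∀ k → s (suc k) ≡ s k ⊎ s (suc k) ≡ suc (s k)) → Walk G
  reindex w s lazy = walk (at w ∘ s) steps
    where
    steps : ∀ k → G ⊢ at w (s k) ≃ at w (s (suc k))
    steps k with lazy k
    ... | inj₁ e = inj₁ (cong (at w) (sym e))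
    ... | inj₂ e = subst (λ t → G ⊢ at w (s k) ≃ at w t) (sym e) (step w (s k))

  reverse : Walk G → ℕ → Walk G
  reverse w n = walk (λ k → at w (n ∸ k)) (steps n)
    where
    steps : ∀ n k → G ⊢ at w (n ∸ k) ≃ at w (n ∸ suc k)
    steps zero    zero    = ≃-refl G
    steps zero    (suc k) = ≃-refl G
    steps (suc n) zero    = ≃-sym G (step w n)
    steps (suc n) (suc k) = steps n k

  concatAt : Walk G → ℕ → Walk G → ℕ → V G
  concatAt w zero    w' = at w'
  concatAt w (suc m) w' zero    = at w 0
  concatAt w (suc m) w' (suc k) = concatAt (tail w) m w' k

  concatAt-left : ∀ w m w' → at w m ≡ at w' 0 → ∀ {k} → k ≤ m → concatAt w m w' k ≡ at w k
  concatAt-left w zero    w' j z≤n     = sym j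
  concatAt-left w (suc m) w' j z≤n     = refl
  concatAt-left w (suc m) w' j (s≤s k) = concatAt-left (tail w) m w' j k

  concatAt-right : ∀ w m w' k → concatAt w m w' (m + k) ≡ at w' k
  concatAt-right w zero    w' k = refl
  concatAt-right w (suc m) w' k = concatAt-right (tail w) m w' k

  concatAt-step : ∀ w m w' → at w m ≡ at w' 0 → ∀ k → G ⊢ concatAt w m w' k ≃ concatAt w m w' (suc k)
  concatAt-step w zero    w' j k       = step w' k
  concatAt-step w (suc m) w' j zero    =
    subst (G ⊢ at w 0 ≃_) (sym (concatAt-left (tail w) m w' j z≤n)) (step w 0)
  concatAt-step w (suc m) w' j (suc k) = concatAt-step (tail w) m w' j k

  concat : (w : Walk G) (m : ℕ) (w' : Walk G) → at w m ≡ at w' 0 → Walk G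
  concat w m w' j = walk (concatAt w m w') (concatAt-step w m w' j)

mapWalk : ∀ {G H} → GraphMap G H → Walk G → Walk H
mapWalk f w = walk (fun f ∘ at w) (≃-map f ∘ step w)

clamp : (n : ℕ) → ℕ → Fin (suc n)
clamp zero    k       = fzero
clamp (suc n) zero    = fzero
clamp (suc n) (suc k) = fsuc (clamp n k)

clamp-zero : ∀ n → clamp n 0 ≡ fzero
clamp-zero zero    = refl
clamp-zero (suc n) = refl

clamp-self : ∀ n → clamp n n ≡ fromℕ n
clamp-self zero    = refl
clamp-self (suc n) = cong fsuc (clamp-self n)

clamp-toℕ : ∀ n (i : Fin (suc n)) → clamp n (toℕ i) ≡ i
clamp-toℕ zero    fzero    = refl
clamp-toℕ (suc n) fzero    = refl
clamp-toℕ (suc n) (fsuc i) = cong fsuc (clamp-toℕ n i)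

toℕ-clamp : ∀ n {k} → k ≤ n → toℕ (clamp n k) ≡ k
toℕ-clamp zero    z≤n     = refl
toℕ-clamp (suc n) z≤n     = refl
toℕ-clamp (suc n) (s≤s k) = cong suc (toℕ-clamp n k)

clamp-step : ∀ n k → clamp n (suc k) ≡ clamp n k ⊎ toℕ (clamp n (suc k)) ≡ suc (toℕ (clamp n k))
clamp-step zero    k    = inj₁ refl
clamp-step (suc n) zero = inj₂ (cong (suc ∘ toℕ) (clamp-zero n))
clamp-step (suc n) (suc k) with clamp-step n k
... | inj₁ e = inj₁ (cong fsuc e)
... | inj₂ e = inj₂ (cong suc e)

module _ {G : Graph} where

  pathToWalk : ∀ {n} → Path G n → Walk G
  pathToWalk {n} γ = walk (fun γ ∘ clamp n) steps
    where
    steps : ∀ k → G ⊢ fun γ (clamp n k) ≃ fun γ (clamp n (suc k))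
    steps k with clamp-step n k
    ... | inj₁ e = inj₁ (cong (fun γ) (sym e))
    ... | inj₂ e = pres γ (inj₁ e)

  pathToWalk-start : ∀ {n} (γ : Path G n) → at (pathToWalk γ) 0 ≡ fun γ fzero
  pathToWalk-start {n} γ = cong (fun γ) (clamp-zero n)

  pathToWalk-end : ∀ {n} (γ : Path G n) → at (pathToWalk γ) n ≡ fun γ (fromℕ n)
  pathToWalk-end {n} γ = cong (fun γ) (clamp-self n)

  walkToPath : Walk G → (n : ℕ) → Path G n
  walkToPath w n = record { fun = at w ∘ toℕ ; pres = pres′ }
    where
    pres′ : ∀ {i j} → E (I n) i j → G ⊢ at w (toℕ i) ≃ at w (toℕ j)
    pres′ {i} (inj₁ e) = subst (λ t → G ⊢ at w (toℕ i) ≃ at w t) (sym e) (step w (toℕ i))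
    pres′ {_} {j} (inj₂ e) =
      ≃-sym G (subst (λ t → G ⊢ at w (toℕ j) ≃ at w t) (sym e) (step w (toℕ j)))

  pathToWalk-walkToPath : ∀ w n {k} → k ≤ n → at (pathToWalk (walkToPath w n)) k ≡ at w k
  pathToWalk-walkToPath w n k≤n = cong (at w) (toℕ-clamp n k≤n)

  walkToLoop : ∀ {y} (w : Walk G) (n : ℕ) → at w 0 ≡ y → at w n ≡ y → Loop G y n
  walkToLoop w n e₀ eₙ = record
    { path = walkToPath w n ; start = e₀ ; end = trans (cong (at w) (toℕ-fromℕ n)) eₙ }

module _ {G H : Graph} (f : GraphMap G H) where

  mapLoop : ∀ {y n} → Loop G y n → Loop H (fun f y) n
  mapLoop ℓ = record { path = f ∘ᴳ path ℓ ; start = cong (fun f) (start ℓ) ; end = cong (fun f) (end ℓ) }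

  mapAnyLoop : ∀ {y} → AnyLoop G y → AnyLoop H (fun f y)
  mapAnyLoop (n , ℓ) = n , mapLoop ℓ

  mapHStep : ∀ {y ℓ ℓ'} → HStep G y ℓ ℓ' → HStep H (fun f y) (mapAnyLoop ℓ) (mapAnyLoop ℓ')
  mapHStep (adj α β close)  = adj (mapLoop α) (mapLoop β) (≃-map f ∘ close)
  mapHStep (rep α β ρ α≡βρ) = rep (mapLoop α) (mapLoop β) ρ (cong (fun f) ∘ α≡βρ)

  map-PathHomotopic : ∀ {y ℓ ℓ'} → PathHomotopic G y ℓ ℓ' →
                      PathHomotopic H (fun f y) (mapAnyLoop ℓ) (mapAnyLoop ℓ')
  map-PathHomotopic = gmap mapAnyLoop mapHStep

module Reparamᵖ {m n : ℕ} (ρ : Reparam m n) where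
  open Reparam ρ

  r-zero : toℕ (r fzero) ≡ 0
  r-zero with surj fzero
  ... | i , ri≡0 = ≤-antisym (subst (λ t → toℕ (r fzero) ≤ toℕ t) ri≡0 (mono fzero i z≤n)) z≤n

  r-last : toℕ (r (fromℕ m)) ≡ n
  r-last with surj (fromℕ n)
  ... | i , ri≡n = ≤-antisym (toℕ≤pred[n] (r (fromℕ m)))
    (subst (_≤ toℕ (r (fromℕ m))) (trans (cong toℕ ri≡n) (toℕ-fromℕ n))
      (mono i (fromℕ m) (subst (toℕ i ≤_) (sym (toℕ-fromℕ m)) (toℕ≤pred[n] i))))

  -- A jump over a + 1 would leave a + 1 outside the image.
  r-step-bounded : ∀ c c' → toℕ c' ≡ suc (toℕ c) → toℕ (r c') ≤ suc (toℕ (r c))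
  r-step-bounded c c' c'≡1+c = ≮⇒≥ jump
    where
    a = toℕ (r c)
    b = toℕ (r c')
    jump : suc a < b → ⊥
    jump 2+a≤b = missed (surj (fromℕ< a+1<1+n))
      where
      a+1<1+n : suc a < suc n
      a+1<1+n = s≤s (≤-trans (n≤1+n _) (≤-trans 2+a≤b (toℕ≤pred[n] (r c'))))
      lands-on-a+1 : ∀ k → toℕ (r k) ≡ suc a → ⊥
      lands-on-a+1 k rk with toℕ k ≤? toℕ c
      ... | yes k≤c = 1+n≰n (subst (_≤ a) rk (mono k c k≤c))
      ... | no k≰c  = 1+n≰n (≤-trans 2+a≤b (subst (b ≤_) rk
                        (mono c' k (subst (_≤ toℕ k) (sym c'≡1+c) (≰⇒> k≰c)))))
      missed : Σ (Fin (suc m)) (λ k → r k ≡ fromℕ< a+1<1+n) → ⊥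
      missed (k , rk≡a+1) = lands-on-a+1 k (trans (cong toℕ rk≡a+1) (toℕ-fromℕ< a+1<1+n))

  r-step : ∀ c c' → toℕ c' ≡ suc (toℕ c) →
           toℕ (r c') ≡ toℕ (r c) ⊎ toℕ (r c') ≡ suc (toℕ (r c))
  r-step c c' c'≡1+c with m≤n⇒m<n∨m≡n (r-step-bounded c c' c'≡1+c)
  ... | inj₁ b<1+a =
    inj₁ (≤-antisym (≤-pred b<1+a) (mono c c' (subst (toℕ c ≤_) (sym c'≡1+c) (n≤1+n _))))
  ... | inj₂ b≡1+a = inj₂ b≡1+a

  r∘clamp-step : ∀ k → toℕ (r (clamp m (suc k))) ≡ toℕ (r (clamp m k))
                     ⊎ toℕ (r (clamp m (suc k))) ≡ suc (toℕ (r (clamp m k)))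
  r∘clamp-step k with clamp-step m k
  ... | inj₁ e = inj₁ (cong (toℕ ∘ r) e)
  ... | inj₂ e = r-step (clamp m k) (clamp m (suc k)) e

module Lifting {Q X : Graph} {q : GraphMap Q X} (cov : IsCovering q) where
  open IsCovering cov

  ≃-over-same⇒≡ : ∀ {a b} → Q ⊢ a ≃ b → fun q a ≡ fun q b → a ≡ b
  ≃-over-same⇒≡ {a} ab = locInj a a _ (≃-refl Q) ab

  lift-unique : (l l' : Walk Q) → at l 0 ≡ at l' 0 →
                ∀ n → (∀ k → k ≤ n → fun q (at l k) ≡ fun q (at l' k)) → at l n ≡ at l' n
  lift-unique l l' e₀ zero    over = e₀
  lift-unique l l' e₀ (suc n) over =
    locInj (at l n) _ _ (step l n) (subst (Q ⊢_≃ at l' (suc n)) (sym same-at-n) (step l' n))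
      (over (suc n) ≤-refl)
    where
    same-at-n : at l n ≡ at l' n
    same-at-n = lift-unique l l' e₀ n (λ k k≤n → over k (≤-trans k≤n (n≤1+n n)))

  private
    lift-edge : ∀ {x x'} (z : V Q) → fun q z ≡ x → X ⊢ x ≃ x' →
                Σ (V Q) λ z' → Q ⊢ z ≃ z' × fun q z' ≡ x'
    lift-edge z refl xx' = locSurj z _ xx'

    lifted : (w : Walk X) (z : V Q) → fun q z ≡ at w 0 → (k : ℕ) → Σ (V Q) λ z' → fun q z' ≡ at w k
    lifted w z e zero    = z , e
    lifted w z e (suc k) = proj₁ next , proj₂ (proj₂ next)
      where next = lift-edge (proj₁ (lifted w z e k)) (proj₂ (lifted w z e k)) (step w k)

  lift : (w : Walk X) (z : V Q) → fun q z ≡ at w 0 → Walk Q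
  lift w z e = walk (proj₁ ∘ lifted w z e)
    (λ k → proj₁ (proj₂ (lift-edge (proj₁ (lifted w z e k)) (proj₂ (lifted w z e k)) (step w k))))

  lift-over : ∀ w z e k → fun q (at (lift w z e) k) ≡ at w k
  lift-over w z e k = proj₂ (lifted w z e k)

  square-closes : ∀ {a b c d} → Q ⊢ a ≃ b → Q ⊢ b ≃ c → Q ⊢ c ≃ d →
                  X ⊢ fun q a ≃ fun q d → Q ⊢ a ≃ d
  square-closes {a} {b} {c} {d} ab bc cd ad = square u v refl refl refl refl
    where
    vertices : ℕ → V Q
    vertices 0 = a
    vertices 1 = b
    vertices 2 = c
    vertices _ = d
    steps : ∀ k → Q ⊢ vertices k ≃ vertices (suc k)
    steps 0 = ab
    steps 1 = bc
    steps 2 = cd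
    steps (suc (suc (suc _))) = ≃-refl Q
    u : GraphMap (I 3) Q
    u = walkToPath (walk vertices steps) 3
    corner : Fin 2 → Fin 2 → V X
    corner fzero        fzero        = fun q b
    corner fzero        (fsuc fzero) = fun q c
    corner (fsuc fzero) fzero        = fun q a
    corner (fsuc fzero) (fsuc fzero) = fun q d
    v : GraphMap (I 1 □ I 1) X
    v = square-map X corner
      (λ { fzero → ≃-map q bc ; (fsuc fzero) → ad })
      (λ { fzero → ≃-map q (≃-sym Q ab) ; (fsuc fzero) → ≃-map q cd })

  liftLoop : ∀ {x n} (z : V Q) → fun q z ≡ x → Loop X x n → Walk Q
  liftLoop z e α = lift (pathToWalk (path α)) z (trans e (sym (trans (pathToWalk-start (path α)) (start α))))

  liftLoop-over : ∀ {x n} z e (α : Loop X x n) k → fun q (at (liftLoop z e α) k) ≡ fun (path α) (clamp n k)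
  liftLoop-over z e α = lift-over (pathToWalk (path α)) z _

  liftLoop-end-over : ∀ {x n} z e (α : Loop X x n) → fun q (at (liftLoop z e α) n) ≡ x
  liftLoop-end-over z e α = trans (liftLoop-over z e α _) (trans (pathToWalk-end (path α)) (end α))

  liftedEndpoint : ∀ {x} (z : V Q) → fun q z ≡ x → AnyLoop X x → V Q
  liftedEndpoint z e (n , α) = at (liftLoop z e α) n

  liftedEndpoint-HStep : ∀ {x} z (e : fun q z ≡ x) {ℓ ℓ'} → HStep X x ℓ ℓ' →
                         liftedEndpoint z e ℓ ≡ liftedEndpoint z e ℓ'
  liftedEndpoint-HStep z e (adj {n} α β close) =
    ≃-over-same⇒≡ (lifts-adjacent n) (trans (liftLoop-end-over z e α) (sym (liftLoop-end-over z e β)))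
    where
    A = liftLoop z e α
    B = liftLoop z e β
    lifts-adjacent : ∀ k → Q ⊢ at A k ≃ at B k
    lifts-adjacent zero    = ≃-refl Q
    lifts-adjacent (suc k) = square-closes (≃-sym Q (step A k)) (lifts-adjacent k) (step B k)
      (subst₂ (X ⊢_≃_) (sym (liftLoop-over z e α (suc k))) (sym (liftLoop-over z e β (suc k)))
        (close (clamp n (suc k))))
  liftedEndpoint-HStep z e (rep {m} {n} α β ρ α≡βρ) =
    trans (lift-unique A B∘ρ (sym (cong (at B) (trans (cong (toℕ ∘ r) (clamp-zero m)) r-zero))) m over)
      (cong (at B) (trans (cong (toℕ ∘ r) (clamp-self m)) r-last))
    where
    open Reparam ρ
    open Reparamᵖ ρ
    A = liftLoop z e α
    B = liftLoop z e β
    B∘ρ = reindex B (toℕ ∘ r ∘ clamp m) r∘clamp-step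
    over : ∀ k → k ≤ m → fun q (at A k) ≡ fun q (at B∘ρ k)
    over k _ = trans (liftLoop-over z e α k) (trans (α≡βρ (clamp m k))
      (sym (trans (liftLoop-over z e β _) (cong (fun (path β)) (clamp-toℕ n (r (clamp m k)))))))

  liftedEndpoint-invariant : ∀ {x} z (e : fun q z ≡ x) {ℓ ℓ'} → PathHomotopic X x ℓ ℓ' →
                             liftedEndpoint z e ℓ ≡ liftedEndpoint z e ℓ'
  liftedEndpoint-invariant z e = gfold isEquivalence (liftedEndpoint z e) (liftedEndpoint-HStep z e)

module Classifying {X : Graph} {x₀ : V X} (P : PointedCovering X x₀)
                   (Y-simply-connected : SimplyConnected (Tot P)) (Q : PointedCovering X x₀) where
  open Lifting (cov Q)
  open ≡-Reasoning

  private
    Y = Tot P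
    Z = Tot Q
    p = proj P
    q = proj Q
    y₀ = base P
    z₀ = base Q

  liftFromBase : (w : Walk Y) → at w 0 ≡ y₀ → Walk Z
  liftFromBase w e = lift (mapWalk p w) z₀ (trans (pt Q) (sym (trans (cong (fun p) e) (pt P))))

  liftFromBase-over : ∀ w e k → fun q (at (liftFromBase w e) k) ≡ fun p (at w k)
  liftFromBase-over w e = lift-over (mapWalk p w) z₀ _

  liftFromBase-unique : (l : Walk Z) (w : Walk Y) (e : at w 0 ≡ y₀) → at l 0 ≡ z₀ →
                        ∀ n → (∀ k → k ≤ n → fun q (at l k) ≡ fun p (at w k)) →
                        at l n ≡ at (liftFromBase w e) n
  liftFromBase-unique l w e l₀ n over =
    lift-unique l (liftFromBase w e) l₀ n (λ k k≤n → trans (over k k≤n) (sym (liftFromBase-over w e k)))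

  liftFromBase-closed : (w : Walk Y) (e : at w 0 ≡ y₀) →
                        ∀ n → at w n ≡ y₀ → at (liftFromBase w e) n ≡ z₀
  liftFromBase-closed w e n eₙ =
    trans (sym (liftFromBase-unique (liftLoop z₀ e₀ (mapLoop p L)) w e refl n over))
      (liftedEndpoint-invariant z₀ e₀ (map-PathHomotopic p (proj₂ Y-simply-connected y₀ (n , L))))
    where
    L = walkToLoop w n e eₙ
    e₀ : fun q z₀ ≡ fun p y₀
    e₀ = trans (pt Q) (sym (pt P))
    over : ∀ k → k ≤ n → fun q (at (liftLoop z₀ e₀ (mapLoop p L)) k) ≡ fun p (at w k)
    over k k≤n = trans (liftLoop-over z₀ e₀ (mapLoop p L) k) (cong (fun p) (pathToWalk-walkToPath w n k≤n))

  -- Go along w and back along w': a loop at y₀, whose lift is therefore closed.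
  liftFromBase-endpoint : (w w' : Walk Y) (e : at w 0 ≡ y₀) (e' : at w' 0 ≡ y₀) (m n : ℕ) →
                          at w m ≡ at w' n → at (liftFromBase w e) m ≡ at (liftFromBase w' e') n
  liftFromBase-endpoint w w' e e' m n j = trans (sym prefix) suffix
    where
    L = concat w m (reverse w' n) j
    eL = trans (concatAt-left w m _ j z≤n) e
    M = liftFromBase L eL
    L-back : ∀ {k} → k ≤ n → at L (m + n ∸ k) ≡ at w' k
    L-back {k} k≤n = begin
      at L (m + n ∸ k)          ≡⟨ cong (at L) (+-∸-assoc m k≤n) ⟩
      at L (m + (n ∸ k))        ≡⟨ concatAt-right w m _ (n ∸ k) ⟩
      at w' (n ∸ (n ∸ k))       ≡⟨ cong (at w') (m∸[m∸n]≡n k≤n) ⟩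
      at w' k                   ∎
    M-closed : at M (m + n) ≡ z₀
    M-closed = liftFromBase-closed L eL (m + n) (trans (L-back z≤n) e')
    prefix : at M m ≡ at (liftFromBase w e) m
    prefix = liftFromBase-unique M w e refl m
      (λ k k≤m → trans (liftFromBase-over L eL k) (cong (fun p) (concatAt-left w m _ j k≤m)))
    suffix : at M m ≡ at (liftFromBase w' e') n
    suffix = trans (cong (at M) (sym (m+n∸n≡m m n)))
      (liftFromBase-unique (reverse M (m + n)) w' e' M-closed n
        (λ k k≤n → trans (liftFromBase-over L eL _) (cong (fun p) (L-back k≤n))))

  private
    connection : ∀ y → Σ ℕ λ n → Σ (Path Y n) λ γ → (fun γ fzero ≡ y₀) × (fun γ (fromℕ n) ≡ y)
    connection = proj₁ Y-simply-connected y₀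
    len : V Y → ℕ
    len y = proj₁ (connection y)
    route-path : ∀ y → Path Y (len y)
    route-path y = proj₁ (proj₂ (connection y))
    route : V Y → Walk Y
    route y = pathToWalk (route-path y)
    route-start : ∀ y → at (route y) 0 ≡ y₀
    route-start y = trans (pathToWalk-start (route-path y)) (proj₁ (proj₂ (proj₂ (connection y))))
    route-end : ∀ y → at (route y) (len y) ≡ y
    route-end y = trans (pathToWalk-end (route-path y)) (proj₂ (proj₂ (proj₂ (connection y))))

  classify : V Y → V Z
  classify y = at (liftFromBase (route y) (route-start y)) (len y)

  classify-pres : ∀ {y y'} → E Y y y' → Z ⊢ classify y ≃ classify y'
  classify-pres {y} {y'} yy' = subst₂ (Z ⊢_≃_) (sym at-n) (sym at-1+n) (step M n)
    where
    n = len y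
    W = concat (route y) n (edgeWalk yy') (route-end y)
    W-prefix : ∀ {k} → k ≤ n → at W k ≡ at (route y) k
    W-prefix = concatAt-left (route y) n (edgeWalk yy') (route-end y)
    eW = trans (W-prefix z≤n) (route-start y)
    M = liftFromBase W eW
    at-n : classify y ≡ at M n
    at-n = liftFromBase-endpoint (route y) W _ eW n n (sym (W-prefix ≤-refl))
    at-1+n : classify y' ≡ at M (suc n)
    at-1+n = liftFromBase-endpoint (route y') W _ eW (len y') (suc n)
      (trans (route-end y') (sym (trans (cong (at W) (+-comm 1 n))
        (concatAt-right (route y) n (edgeWalk yy') 1))))

  classify-base : classify y₀ ≡ z₀
  classify-base =
    liftFromBase-endpoint (route y₀) (constWalk y₀) (route-start y₀) refl (len y₀) 0 (route-end y₀)

  classify-over : ∀ y → fun q (classify y) ≡ fun p y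
  classify-over y = trans (liftFromBase-over (route y) (route-start y) (len y)) (cong (fun p) (route-end y))

  classifying : CovMor P Q
  classifying = record
    { map = record { fun = classify ; pres = classify-pres } ; pt = classify-base ; comm = classify-over }

  classifying-unique : (g : CovMor P Q) → ∀ y → fun (map g) y ≡ classify y
  classifying-unique g y = trans (cong (fun (map g)) (sym (route-end y)))
    (liftFromBase-unique (mapWalk (map g) (route y)) (route y) (route-start y)
      (trans (cong (fun (map g)) (route-start y)) (CovMor.pt g)) (len y) (λ k _ → comm g _))

proposition4p26 : (X : Graph) (x₀ : V X) (P : PointedCovering X x₀) →
    SimplyConnected (Tot P) → IsUniversalCover P
proposition4p26 X x₀ P Y-simply-connected Q =
  Classifying.classifying P Y-simply-connected Q , Classifying.classifying-unique P Y-simply-connected Q
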